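{- Let $\sigma$ be a well-shaped state of type $(0,b_0,c_0,d_0)$. For all integers $b,c,d$ with $$0\le b\le\lceil b_0/2\rceil,\quad 0\le c\le\lceil c_0/2\rceil,\quad 0\le d\le d_0,$$ there exists a $4$-interval question $Q$ of type $[0,b,c,d]$ in $\sigma$ such that both resulting states $\sigma_{yes}$ and $\sigma_{no}$ are well shaped.
   Context: Setting: $\mathcal U=\{0,\dots,2^m-1\}$, viewed cyclically, and the game allows $3$ lies. States: a state is a map $\sigma:\mathcal U\to\{0,\dots,4\}$ of type $(|\sigma^{ -1}(0)|,\dots,|\sigma^{ -1}(3)|)$. Its support is $\Sigma=\{y:\sigma(y)\le3\}$. Answers: $\sigma_{yes}(y)=\min\{\sigma(y)+[y\notin Q],4\}$ and $\sigma_{no}(y)=\min\{\sigma(y)+[y\in Q],4\}$. Question type: the type of $Q$ in $\sigma$ is $[|Q\cap\sigma^{ -1}(i)|]_{i=0..3}$. Intervals: an interval is empty or a set of cyclically consecutive elements of $\mathcal U$. A $4$-interval question is a union of at most four intervals. Well shaped: order $\Sigma$ cyclically. The state is well shaped if $\Sigma$ splits into twelve possibly empty sets of cyclically consecutive elements of $\Sigma$, in cyclic order, on which $\sigma$ is constant with values either $2,1,0,1,2,3,2,1,2,3,2,3$ or $2,1,0,1,2,1,2,3,2,3,2,3$. -}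

module Defs where

open import Data.Nat using (ℕ; zero; suc; _+_; _∸_; _^_; _≤_; _<_; _≤ᵇ_; _≡ᵇ_; ⌈_/2⌉)
open import Data.Nat.Base using (_⊓_)
open import Data.Bool using (Bool; true; false; if_then_else_)
open import Data.Fin using (Fin; toℕ)
open import Data.List using (List; []; _∷_; _++_; replicate; filter; map; length; allFin; drop; take)
open import Data.Vec using (Vec; []; _∷_; lookup)
open import Data.Product using (Σ; ∃; _×_; _,_)
open import Data.Sum using (_⊎_)
open import Relation.Binary.PropositionalEquality using (_≡_)
open import Relation.Nullary.Decidable using (Dec)
open import Relation.Unary using (Decidable)
open import Data.Bool.Properties using (T?)
open import Data.Bool using (T)
open import Function.Bundles using (_⇔_)

U : ℕ → Set
U m = Fin (2 ^ m)

StateFn : ℕ → Set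
StateFn m = U m → ℕ

IsState : ∀ m → StateFn m → Set
IsState m σ = ∀ y → σ y ≤ 4

Question : ℕ → Set
Question m = U m → Bool

[_] : Bool → ℕ
[ true ] = 1
[ false ] = 0

σyes : ∀ m → StateFn m → Question m → StateFn m
σyes m σ Q y = (σ y + [ if Q y then false else true ]) ⊓ 4

σno : ∀ m → StateFn m → Question m → StateFn m
σno m σ Q y = (σ y + [ Q y ]) ⊓ 4

count : ∀ m → StateFn m → ℕ → ℕ
count m σ i = length (filter (λ y → T? (σ y ≡ᵇ i)) (allFin (2 ^ m)))

qcount : ∀ m → StateFn m → Question m → ℕ → ℕ
qcount m σ Q i = length (filter (λ y → T? (if Q y then (σ y ≡ᵇ i) else false)) (allFin (2 ^ m)))

offset : ∀ {N} → Fin N → Fin N → ℕ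
offset {N} s y = if toℕ s ≤ᵇ toℕ y then toℕ y ∸ toℕ s else (toℕ y + N) ∸ toℕ s

InInterval : ∀ {N} → Fin N → ℕ → Fin N → Set
InInterval s ℓ y = offset s y < ℓ

-- Q is a union of at most four intervals (empty ones allowed).
FourInterval : ∀ m → Question m → Set
FourInterval m Q =
  Σ (Vec (U m) 4) λ starts → Σ (Vec ℕ 4) λ lens →
    (∀ j → lookup lens j ≤ 2 ^ m) ×
    (∀ y → (Q y ≡ true) ⇔ (∃ λ (j : Fin 4) → InInterval (lookup starts j) (lookup lens j) y))

supportValues : ∀ m → StateFn m → List ℕ
supportValues m σ = map σ (filter (λ y → T? (σ y ≤ᵇ 3)) (allFin (2 ^ m)))

rotate : ℕ → List ℕ → List ℕ
rotate k xs = drop k xs ++ take k xs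

fill : ∀ {k} → Vec ℕ k → Vec ℕ k → List ℕ
fill [] [] = []
fill (p ∷ ps) (n ∷ ns) = replicate n p ++ fill ps ns

patternA : Vec ℕ 12
patternA = 2 ∷ 1 ∷ 0 ∷ 1 ∷ 2 ∷ 3 ∷ 2 ∷ 1 ∷ 2 ∷ 3 ∷ 2 ∷ 3 ∷ []

patternB : Vec ℕ 12
patternB = 2 ∷ 1 ∷ 0 ∷ 1 ∷ 2 ∷ 1 ∷ 2 ∷ 3 ∷ 2 ∷ 3 ∷ 2 ∷ 3 ∷ []

-- Well shaped: the cyclically ordered support splits into twelve (possibly empty)
-- blocks of cyclically consecutive elements, with σ constant on each block
-- and the block values following patternA or patternB.
WellShaped : ∀ m → StateFn m → Set
WellShaped m σ =
  Σ ℕ λ k → Σ (Vec ℕ 12) λ lens →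
    (fill patternA lens ≡ rotate k (supportValues m σ)) ⊎
    (fill patternB lens ≡ rotate k (supportValues m σ))

-- Merging the two 1-blocks around the empty 0-block, the support of σ is cyclically a sequence of ten
-- runs with values 2 1 2 3 2 1 2 3 2 3 (pattern A) or 2 1 2 1 2 3 2 3 2 3 (pattern B). For each value,
-- the question takes some runs whole and a prefix or a suffix of one further run: the threes greedily,
-- and the ones and twos greedily over all their runs but one, or else from that one run alone, which
-- the bound ⌈x/2⌉ makes possible. Whether the asked elements form at most five stretches of the cyclic
-- order (four intervals, as the first and last stretch merge across the end of U) and whether both
-- answers are again runs of pattern A or B depends only on the values and the choice of modes, not on
-- the run lengths; the 2·5·3 choices for each pattern are checked by evaluation.

module Submission where

open import Defs
open import Data.Bool using (Bool; true; false; T; if_then_else_)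
open import Data.Bool.Properties using (T?)
import Data.Bool.Properties as Bool
open import Data.Empty using (⊥)
open import Data.Unit using (tt)
open import Data.Fin using (Fin; toℕ; zero; suc; fromℕ<; #_)
open import Data.Fin.Properties using (any?; all?; toℕ<n; toℕ-fromℕ<)
open import Data.List
  using (List; []; _∷_; _++_; map; concatMap; filter; filterᵇ; length; replicate; drop; take; tabulate; allFin)
open import Data.List.Properties
  using (map-replicate; length-replicate; length-map; ∷-injective; ++-assoc; ++-identityʳ; map-++; map-∘; map-id;
         length-++; filter-++; filter-accept; filter-reject; take++drop≡id; map-tabulate; tabulate-cong; drop-map; take-map)
open import Data.List.NonEmpty using (List⁺; _∷_; toList)
open import Data.List.Relation.Unary.All using (All; []; _∷_)
open import Data.Nat
  using (ℕ; zero; suc; _+_; _∸_; _^_; _≤_; _<_; _≤ᵇ_; _≡ᵇ_; _⊓_; z≤n; z<s; s<s; ⌈_/2⌉; _≤?_; _<?_; NonZero)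
open import Data.Nat.DivMod using (_%_; m%n<n; m%n≤n; m%n%n≡m%n; %-distribˡ-+; [m+n]%n≡m%n; m<n⇒m%n≡m)
open import Data.Nat.Properties
import Data.Nat.Properties as ℕ
open import Data.Nat.Tactic.RingSolver using (solve-∀)
open import Data.Product using (Σ; ∃; ∃₂; _×_; _,_; proj₁; proj₂; uncurry)
open import Data.Sum using (_⊎_; inj₁; inj₂)
open import Data.Vec using (Vec; []; _∷_; lookup; sum)
import Data.Vec as Vec
open import Data.Vec.Relation.Binary.Pointwise.Inductive as Pointwise using (Pointwise; []; _∷_)
open import Function using (id; const; _∘_)
open import Function.Bundles using (_⇔_; mk⇔)
open import Function.Construct.Composition using () renaming (equivalence to ⇔-trans)
open Function.Bundles.Equivalence using () renaming (to to ⇔-to; from to ⇔-from)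
open import Level using (Level)
open import Relation.Binary.Definitions using (DecidableEquality)
open import Relation.Binary.PropositionalEquality hiding ([_])
open import Relation.Nullary using (¬_; contradiction)
open import Relation.Nullary.Decidable using (Dec; does; yes; no; _×-dec_; _⊎-dec_; does-⇔; toWitness)
open import Relation.Unary using (Pred; Decidable)

private variable
  p : Level
  k c : ℕ
  A B : Set

filter-map : {P : Pred B p} (P? : Decidable P) (f : A → B) (xs : List A) →
  filter P? (map f xs) ≡ map f (filter (λ x → P? (f x)) xs)
filter-map P? f [] = refl
filter-map P? f (x ∷ xs) with does (P? (f x))
... | true = cong (f x ∷_) (filter-map P? f xs)
... | false = filter-map P? f xs

filter-++⁻ : {P : Pred A p} (P? : Decidable P) (xs ys zs : List A) → filter P? xs ≡ ys ++ zs →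
  ∃₂ λ u v → xs ≡ u ++ v × filter P? u ≡ ys × filter P? v ≡ zs
filter-++⁻ P? xs [] zs eq = [] , xs , refl , refl , eq
filter-++⁻ P? (x ∷ xs) (y ∷ ys) zs eq with P? x
... | no ¬px with u , v , refl , eu , ev ← filter-++⁻ P? xs (y ∷ ys) zs eq
  = x ∷ u , v , refl , trans (filter-reject P? ¬px) eu , ev
... | yes px with refl , eq′ ← ∷-injective eq
  with u , v , refl , eu , ev ← filter-++⁻ P? xs ys zs eq′
  = x ∷ u , v , refl , trans (filter-accept P? px) (cong (x ∷_) eu) , ev

filterᵇ-replicate-accept : (p : A → Bool) (n : ℕ) {x : A} → p x ≡ true → filterᵇ p (replicate n x) ≡ replicate n x
filterᵇ-replicate-accept p zero e = refl
filterᵇ-replicate-accept p (suc n) {x} e rewrite e = cong (x ∷_) (filterᵇ-replicate-accept p n e)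

filterᵇ-replicate-reject : (p : A → Bool) (n : ℕ) {x : A} → p x ≡ false → filterᵇ p (replicate n x) ≡ []
filterᵇ-replicate-reject p zero e = refl
filterᵇ-replicate-reject p (suc n) e rewrite e = filterᵇ-replicate-reject p n e

filterᵇ-replicate : (p : A → Bool) (n : ℕ) (x : A) → filterᵇ p (replicate n x) ≡ (if p x then replicate n x else [])
filterᵇ-replicate p n x with p x in e
... | true = filterᵇ-replicate-accept p n e
... | false = filterᵇ-replicate-reject p n e

filterᵇ-map-filterᵇ : (p : B → Bool) (g : A → B) (q : A → Bool) → (∀ x → q x ≡ false → p (g x) ≡ false) →
  (xs : List A) → filterᵇ p (map g xs) ≡ filterᵇ p (map g (filterᵇ q xs))
filterᵇ-map-filterᵇ p g q out [] = refl
filterᵇ-map-filterᵇ p g q out (x ∷ xs) with q x in eq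
... | false rewrite out x eq = filterᵇ-map-filterᵇ p g q out xs
... | true with p (g x)
...   | true = cong (g x ∷_) (filterᵇ-map-filterᵇ p g q out xs)
...   | false = filterᵇ-map-filterᵇ p g q out xs

filterᵇ-const-false : (xs : List A) → filterᵇ (const false) xs ≡ []
filterᵇ-const-false [] = refl
filterᵇ-const-false (_ ∷ xs) = filterᵇ-const-false xs

map-const : (x : B) (xs : List A) → map (const x) xs ≡ replicate (length xs) x
map-const x [] = refl
map-const x (_ ∷ xs) = cong (x ∷_) (map-const x xs)

replicate-+ : ∀ m n (x : A) → replicate (m + n) x ≡ replicate m x ++ replicate n x
replicate-+ zero n x = refl
replicate-+ (suc m) n x = cong (x ∷_) (replicate-+ m n x)

replicate-+-++ : ∀ m n (x : A) xs → replicate m x ++ (replicate n x ++ xs) ≡ replicate (m + n) x ++ xs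
replicate-+-++ m n x xs = trans (sym (++-assoc (replicate m x) _ xs)) (cong (_++ xs) (sym (replicate-+ m n x)))

drop-length-++ : (u v : List A) → drop (length u) (u ++ v) ≡ v
drop-length-++ [] v = refl
drop-length-++ (x ∷ u) v = drop-length-++ u v

take-length-++ : (u v : List A) → take (length u) (u ++ v) ≡ u
take-length-++ [] v = refl
take-length-++ (x ∷ u) v = cong (x ∷_) (take-length-++ u v)

map-proj-injective : (xs ys : List (A × B)) → map proj₁ xs ≡ map proj₁ ys → map proj₂ xs ≡ map proj₂ ys → xs ≡ ys
map-proj-injective [] [] _ _ = refl
map-proj-injective ((a , b) ∷ xs) ((a′ , b′) ∷ ys) e₁ e₂
  with refl , e₁′ ← ∷-injective e₁ | refl , e₂′ ← ∷-injective e₂ = cong ((a , b) ∷_) (map-proj-injective xs ys e₁′ e₂′)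

range : ℕ → ℕ → List ℕ
range a zero = []
range a (suc n) = a ∷ range (suc a) n

range-+ : ∀ a m n → range a (m + n) ≡ range a m ++ range (a + m) n
range-+ a zero n = cong (λ b → range b n) (sym (+-identityʳ a))
range-+ a (suc m) n = cong (a ∷_) (trans (range-+ (suc a) m n) (cong (λ b → range (suc a) m ++ range b n) (sym (+-suc a m))))

length-range : ∀ a n → length (range a n) ≡ n
length-range a zero = refl
length-range a (suc n) = cong suc (length-range (suc a) n)

drop-range : ∀ a r n → drop r (range a (r + n)) ≡ range (a + r) n
drop-range a zero n = cong (λ b → range b n) (sym (+-identityʳ a))
drop-range a (suc r) n = trans (drop-range (suc a) r n) (cong (λ b → range b n) (sym (+-suc a r)))

take-range : ∀ a r n → take r (range a (r + n)) ≡ range a r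
take-range a zero n = refl
take-range a (suc r) n = cong (a ∷_) (take-range (suc a) r n)

map-range : ∀ (f : ℕ → ℕ) a b n → (∀ i → i < n → f (a + i) ≡ b + i) → map f (range a n) ≡ range b n
map-range f a b zero h = refl
map-range f a b (suc n) h = cong₂ _∷_
  (trans (cong f (sym (+-identityʳ a))) (trans (h 0 z<s) (+-identityʳ b)))
  (map-range f (suc a) (suc b) n λ i i<n → trans (cong f (sym (+-suc a i))) (trans (h (suc i) (s<s i<n)) (+-suc b i)))

map-range-cong : (f g : ℕ → A) (a n : ℕ) → (∀ i → i < n → f (a + i) ≡ g (a + i)) → map f (range a n) ≡ map g (range a n)
map-range-cong f g a zero h = refl
map-range-cong f g a (suc n) h = cong₂ _∷_
  (trans (cong f (sym (+-identityʳ a))) (trans (h 0 z<s) (cong g (+-identityʳ a))))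
  (map-range-cong f g (suc a) n λ i i<n → trans (cong f (sym (+-suc a i))) (trans (h (suc i) (s<s i<n)) (cong g (+-suc a i))))

map-range-const : (f : ℕ → A) (a n : ℕ) {c : A} → (∀ i → i < n → f (a + i) ≡ c) → map f (range a n) ≡ replicate n c
map-range-const f a n {c} h = trans (map-range-cong f (const c) a n h)
  (trans (map-const c (range a n)) (cong (λ l → replicate l c) (length-range a n)))

tabulate-range : ∀ a n → tabulate {n = n} (λ i → a + toℕ i) ≡ range a n
tabulate-range a zero = refl
tabulate-range a (suc n) = cong₂ _∷_ (+-identityʳ a) (trans (tabulate-cong (λ i → +-suc a (toℕ i))) (tabulate-range (suc a) n))

map-toℕ-allFin : ∀ n → map toℕ (allFin n) ≡ range 0 n
map-toℕ-allFin n = trans (map-tabulate id toℕ) (tabulate-range 0 n)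

length-allFin : ∀ n → length (allFin n) ≡ n
length-allFin n = trans (sym (length-map toℕ (allFin n))) (trans (cong length (map-toℕ-allFin n)) (length-range 0 n))

-- Rotations

infix 4 _↻_

_↻_ : List A → List A → Set
xs ↻ ys = ∃₂ λ u v → xs ≡ u ++ v × ys ≡ v ++ u

++-↻ : (xs ys : List A) → xs ++ ys ↻ ys ++ xs
++-↻ xs ys = xs , ys , refl , refl

rotation : ℕ → List A → List A
rotation n xs = drop n xs ++ take n xs

rotation-↻ : ∀ n (xs : List A) → xs ↻ rotation n xs
rotation-↻ n xs = take n xs , drop n xs , sym (take++drop≡id n xs) , refl

map-rotation : (f : A → B) (n : ℕ) (xs : List A) → map f (rotation n xs) ≡ rotation n (map f xs)
map-rotation f n xs = trans (map-++ f (drop n xs) (take n xs)) (sym (cong₂ _++_ (drop-map n xs) (take-map n xs)))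

++-≡-++ : (a b c d : List A) → a ++ b ≡ c ++ d →
  (∃ λ w → c ≡ a ++ w × b ≡ w ++ d) ⊎ (∃ λ w → a ≡ c ++ w × d ≡ w ++ b)
++-≡-++ [] b c d eq = inj₁ (c , refl , eq)
++-≡-++ (x ∷ a) b [] d eq = inj₂ (x ∷ a , refl , sym eq)
++-≡-++ (x ∷ a) b (y ∷ c) d eq with refl , eq′ ← ∷-injective eq with ++-≡-++ a b c d eq′
... | inj₁ (w , refl , e) = inj₁ (w , refl , e)
... | inj₂ (w , refl , e) = inj₂ (w , refl , e)

↻-trans : {xs ys zs : List A} → xs ↻ ys → ys ↻ zs → xs ↻ zs
↻-trans (u , v , refl , refl) (p , q , e , refl) with ++-≡-++ v u p q e
... | inj₁ (w , refl , refl) = w , q ++ v , ++-assoc w q v , sym (++-assoc q v w)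
... | inj₂ (w , refl , refl) = u ++ p , w , sym (++-assoc u p w) , ++-assoc w u p

↻-map : (f : A → B) {xs ys : List A} → xs ↻ ys → map f xs ↻ map f ys
↻-map f (u , v , refl , refl) = map f u , map f v , map-++ f u v , map-++ f v u

↻-filter : {P : Pred A p} (P? : Decidable P) {xs ys : List A} → xs ↻ ys → filter P? xs ↻ filter P? ys
↻-filter P? (u , v , refl , refl) = filter P? u , filter P? v , filter-++ P? u v , filter-++ P? v u

↻-filter⁻ : {P : Pred A p} (P? : Decidable P) {xs ys : List A} → filter P? xs ↻ ys →
  ∃ λ zs → xs ↻ zs × filter P? zs ≡ ys
↻-filter⁻ P? {xs} (a , b , e , refl) with u , v , refl , eu , ev ← filter-++⁻ P? xs a b e =
  v ++ u , ++-↻ u v , trans (filter-++ P? v u) (cong₂ _++_ ev eu)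

↻-length : {xs ys : List A} → xs ↻ ys → length xs ≡ length ys
↻-length (u , v , refl , refl) = trans (length-++ u) (trans (+-comm (length u) _) (sym (length-++ v)))

↻⇒rotation : {xs ys : List A} → xs ↻ ys → ∃ λ r → r ≤ length xs × ys ≡ rotation r xs
↻⇒rotation (u , v , refl , refl) =
  length u , subst (length u ≤_) (sym (length-++ u)) (m≤m+n _ _) ,
  sym (cong₂ _++_ (drop-length-++ u v) (take-length-++ u v))

length-rotated : ∀ {n} (f : Fin n → A) r → length (map f (rotation r (allFin n))) ≡ n
length-rotated {n = n} f r =
  trans (length-map f (rotation r (allFin n))) (trans (sym (↻-length (rotation-↻ r (allFin n)))) (length-allFin n))

allFin-↻ : ∀ {n} (f : Fin n → A) {ys} → map f (allFin n) ↻ ys → ∃ λ r → r ≤ n × map f (rotation r (allFin n)) ≡ ys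
allFin-↻ {n = n} f rot with r , r≤ , refl ← ↻⇒rotation rot =
  r , subst (r ≤_) (trans (length-map f (allFin n)) (length-allFin n)) r≤ , map-rotation f r (allFin n)

map-pair-↻ : ∀ {X : Set} (f : X → A) (h : X → B) (xs : List X) r (zs : List (A × B)) →
  map f (rotation r xs) ≡ map proj₁ zs → map h (rotation r xs) ≡ map proj₂ zs → map (λ x → f x , h x) xs ↻ zs
map-pair-↻ f h xs r zs e₁ e₂ = subst (_ ↻_) pairs (↻-map _ (rotation-↻ r xs))
  where
  pairs : map (λ x → f x , h x) (rotation r xs) ≡ zs
  pairs = map-proj-injective _ zs (trans (sym (map-∘ (rotation r xs))) e₁) (trans (sym (map-∘ (rotation r xs))) e₂)

-- Run-length encodings

expand : List (A × ℕ) → List A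
expand [] = []
expand ((x , n) ∷ rs) = replicate n x ++ expand rs

expand-++ : (rs ss : List (A × ℕ)) → expand (rs ++ ss) ≡ expand rs ++ expand ss
expand-++ [] ss = refl
expand-++ ((x , n) ∷ rs) ss = trans (cong (replicate n x ++_) (expand-++ rs ss)) (sym (++-assoc (replicate n x) _ _))

↻-expand : {rs ss : List (A × ℕ)} → rs ↻ ss → expand rs ↻ expand ss
↻-expand (u , v , refl , refl) = expand u , expand v , expand-++ u v , expand-++ v u

runsOf : Vec A k → Vec ℕ k → List (A × ℕ)
runsOf [] [] = []
runsOf (x ∷ xs) (n ∷ ns) = (x , n) ∷ runsOf xs ns

fill-expand : (xs ns : Vec ℕ k) → fill xs ns ≡ expand (runsOf xs ns)
fill-expand [] [] = refl
fill-expand (x ∷ xs) (n ∷ ns) = cong (replicate n x ++_) (fill-expand xs ns)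

length-expand-runsOf : (xs : Vec A k) (ns : Vec ℕ k) → length (expand (runsOf xs ns)) ≡ sum ns
length-expand-runsOf [] [] = refl
length-expand-runsOf (x ∷ xs) (n ∷ ns) =
  trans (length-++ (replicate n x)) (cong₂ _+_ (length-replicate n) (length-expand-runsOf xs ns))

module Embedding (_≟_ : DecidableEquality A) where

  dropLeading : A → List A → List A
  dropLeading y [] = []
  dropLeading y (x ∷ xs) = if does (x ≟ y) then dropLeading y xs else x ∷ xs

  embeds : List A → Vec A k → Bool
  embeds xs (y ∷ pat) = embeds (dropLeading y xs) pat
  embeds [] [] = true
  embeds (_ ∷ _) [] = false

  expand-dropLeading : ∀ y (rs : List (A × ℕ)) → ∃₂ λ m rs′ →
    map proj₁ rs′ ≡ dropLeading y (map proj₁ rs) × expand rs ≡ replicate m y ++ expand rs′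
  expand-dropLeading y [] = 0 , [] , refl , refl
  expand-dropLeading y ((x , n) ∷ rs) with x ≟ y
  ... | no _ = 0 , (x , n) ∷ rs , refl , refl
  ... | yes refl with m , rs′ , e , e′ ← expand-dropLeading y rs =
    n + m , rs′ , e ,
    trans (cong (replicate n y ++_) e′) (trans (sym (++-assoc (replicate n y) _ _)) (cong (_++ _) (sym (replicate-+ n m y))))

  Fills : Vec A k → List A → Set
  Fills pat xs = ∃ λ lens → expand (runsOf pat lens) ≡ xs

  embeds-sound : (rs : List (A × ℕ)) (pat : Vec A k) → T (embeds (map proj₁ rs) pat) → Fills pat (expand rs)
  embeds-sound [] [] _ = [] , refl
  embeds-sound (_ ∷ _) [] ()
  embeds-sound rs (y ∷ pat) h with m , rs′ , e , e′ ← expand-dropLeading y rs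
    with lens , e″ ← embeds-sound rs′ pat (subst (λ xs → T (embeds xs pat)) (sym e) h) =
    m ∷ lens , trans (cong (replicate m y ++_) e″) (sym e′)

-- Well-shaped sequences of values

inSupport : ℕ → Bool
inSupport x = x ≤ᵇ 3

supportRuns : List (ℕ × ℕ) → List (ℕ × ℕ)
supportRuns = filterᵇ (inSupport ∘ proj₁)

supportValues≡ : ∀ m (σ : StateFn m) → supportValues m σ ≡ filterᵇ inSupport (map σ (allFin (2 ^ m)))
supportValues≡ m σ = sym (filter-map (T? ∘ inSupport) σ (allFin (2 ^ m)))

WellShapedValues : List ℕ → Set
WellShapedValues xs = ∃ λ lens → xs ↻ fill patternA lens ⊎ xs ↻ fill patternB lens

wellShaped⇒values : ∀ m σ → WellShaped m σ → WellShapedValues (supportValues m σ)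
wellShaped⇒values m σ (k , lens , inj₁ e) = lens , inj₁ (subst (_ ↻_) (sym e) (rotation-↻ k _))
wellShaped⇒values m σ (k , lens , inj₂ e) = lens , inj₂ (subst (_ ↻_) (sym e) (rotation-↻ k _))

values⇒wellShaped : ∀ m σ → WellShapedValues (supportValues m σ) → WellShaped m σ
values⇒wellShaped m σ (lens , inj₁ r) with k , _ , e ← ↻⇒rotation r = k , lens , inj₁ e
values⇒wellShaped m σ (lens , inj₂ r) with k , _ , e ← ↻⇒rotation r = k , lens , inj₂ e

wellShapedValues-↻ : {xs ys : List ℕ} → xs ↻ ys → WellShapedValues ys → WellShapedValues xs
wellShapedValues-↻ r (lens , inj₁ r′) = lens , inj₁ (↻-trans r r′)
wellShapedValues-↻ r (lens , inj₂ r′) = lens , inj₂ (↻-trans r r′)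

module ℕ-Embedding = Embedding ℕ._≟_
module Bool-Embedding = Embedding Bool._≟_
open ℕ-Embedding using (embeds; embeds-sound)

CyclicallyShaped : List (ℕ × ℕ) → Set
CyclicallyShaped rs = ∃ λ (i : Fin (suc (length rs))) →
  T (embeds (map proj₁ (rotation (toℕ i) rs)) patternA) ⊎ T (embeds (map proj₁ (rotation (toℕ i) rs)) patternB)

cyclicallyShaped? : (rs : List (ℕ × ℕ)) → Dec (CyclicallyShaped rs)
cyclicallyShaped? rs = any? λ i →
  T? (embeds (map proj₁ (rotation (toℕ i) rs)) patternA) ⊎-dec T? (embeds (map proj₁ (rotation (toℕ i) rs)) patternB)

embeds-rotation⇒↻fill : (rs : List (ℕ × ℕ)) (n : ℕ) (pat : Vec ℕ k) → T (embeds (map proj₁ (rotation n rs)) pat) →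
  ∃ λ lens → expand rs ↻ fill pat lens
embeds-rotation⇒↻fill rs n pat h with lens , e ← embeds-sound (rotation n rs) pat h =
  lens , subst (expand rs ↻_) (trans (sym e) (sym (fill-expand pat lens))) (↻-expand (rotation-↻ n rs))

cyclicallyShaped⇒wellShaped : (rs : List (ℕ × ℕ)) → CyclicallyShaped rs → WellShapedValues (expand rs)
cyclicallyShaped⇒wellShaped rs (i , inj₁ h) with lens , r ← embeds-rotation⇒↻fill rs (toℕ i) patternA h = lens , inj₁ r
cyclicallyShaped⇒wellShaped rs (i , inj₂ h) with lens , r ← embeds-rotation⇒↻fill rs (toℕ i) patternB h = lens , inj₂ r

-- Counting

countOf : ℕ → List ℕ → ℕ
countOf i xs = length (filterᵇ (_≡ᵇ i) xs)

countOf-++ : ∀ i xs ys → countOf i (xs ++ ys) ≡ countOf i xs + countOf i ys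
countOf-++ i xs ys = trans (cong length (filter-++ (T? ∘ (_≡ᵇ i)) xs ys)) (length-++ (filterᵇ (_≡ᵇ i) xs))

countOf-replicate : ∀ i n x → countOf i (replicate n x) ≡ (if x ≡ᵇ i then n else 0)
countOf-replicate i n x with x ≡ᵇ i in e
... | true = trans (cong length (filterᵇ-replicate-accept (_≡ᵇ i) n e)) (length-replicate n)
... | false = cong length (filterᵇ-replicate-reject (_≡ᵇ i) n e)

≡ᵇ-outside : ∀ i → inSupport i ≡ true → ∀ x → inSupport x ≡ false → (x ≡ᵇ i) ≡ false
≡ᵇ-outside i hi x hx with x ≡ᵇ i in e
... | false = refl
... | true with refl ← ≡ᵇ⇒≡ x i (subst T (sym e) _) = trans (sym hi) hx

countOf-support : ∀ i → inSupport i ≡ true → ∀ xs → countOf i xs ≡ countOf i (filterᵇ inSupport xs)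
countOf-support i hi xs = cong length (begin
  filterᵇ (_≡ᵇ i) xs                              ≡⟨ cong (filterᵇ (_≡ᵇ i)) (sym (map-id xs)) ⟩
  filterᵇ (_≡ᵇ i) (map id xs)                     ≡⟨ filterᵇ-map-filterᵇ (_≡ᵇ i) id inSupport (≡ᵇ-outside i hi) xs ⟩
  filterᵇ (_≡ᵇ i) (map id (filterᵇ inSupport xs)) ≡⟨ cong (filterᵇ (_≡ᵇ i)) (map-id (filterᵇ inSupport xs)) ⟩
  filterᵇ (_≡ᵇ i) (filterᵇ inSupport xs)          ∎)
  where open ≡-Reasoning

occurrences : ℕ → Vec ℕ k → Vec ℕ k → ℕ
occurrences i [] [] = 0
occurrences i (x ∷ xs) (n ∷ ns) = (if x ≡ᵇ i then n else 0) + occurrences i xs ns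

countOf-fill : ∀ i (xs ns : Vec ℕ k) → countOf i (fill xs ns) ≡ occurrences i xs ns
countOf-fill i [] [] = refl
countOf-fill i (x ∷ xs) (n ∷ ns) =
  trans (countOf-++ i (replicate n x) (fill xs ns)) (cong₂ _+_ (countOf-replicate i n x) (countOf-fill i xs ns))

count≡occurrences : ∀ m (σ : StateFn m) {pat lens : Vec ℕ k} → supportValues m σ ↻ fill pat lens →
  ∀ i → inSupport i ≡ true → count m σ i ≡ occurrences i pat lens
count≡occurrences m σ {pat} {lens} shape i hi = begin
  count m σ i                              ≡⟨ sym (length-map σ (filterᵇ ((_≡ᵇ i) ∘ σ) all)) ⟩
  length (map σ (filterᵇ ((_≡ᵇ i) ∘ σ) all)) ≡⟨ cong length (sym (filter-map (T? ∘ (_≡ᵇ i)) σ all)) ⟩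
  countOf i (map σ all)                    ≡⟨ countOf-support i hi (map σ all) ⟩
  countOf i (filterᵇ inSupport (map σ all)) ≡⟨ ↻-length (↻-filter (T? ∘ (_≡ᵇ i)) (subst (_↻ _) (supportValues≡ m σ) shape)) ⟩
  countOf i (fill pat lens)                ≡⟨ countOf-fill i pat lens ⟩
  occurrences i pat lens                   ∎
  where
  open ≡-Reasoning
  all = allFin (2 ^ m)

-- Segmentations into pieces

record Piece : Set where
  constructor piece
  field
    value : ℕ
    asked : Bool
    size : ℕ

open Piece

data Segmentation : List Piece → List ℕ → Set where
  [] : Segmentation [] []
  segment : ∀ {v q n ps t} (w : List ℕ) → filterᵇ inSupport w ≡ replicate n v →
    Segmentation ps t → Segmentation (piece v q n ∷ ps) (w ++ t)

label : Bool → ℕ → Bool × ℕ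
label q x = q , x

private variable
  ps : List Piece
  t : List ℕ

labelled : Segmentation ps t → List (Bool × ℕ)
labelled [] = []
labelled (segment {q = q} w _ W) = map (label q) w ++ labelled W

answerRuns : Segmentation ps t → List (Bool × ℕ)
answerRuns [] = []
answerRuns (segment {q = q} w _ W) = (q , length w) ∷ answerRuns W

map-proj₂-labelled : (W : Segmentation ps t) → map proj₂ (labelled W) ≡ t
map-proj₂-labelled [] = refl
map-proj₂-labelled (segment {q = q} w _ W) = begin
  map proj₂ (map (label q) w ++ labelled W)          ≡⟨ map-++ proj₂ (map (label q) w) _ ⟩
  map proj₂ (map (label q) w) ++ map proj₂ (labelled W) ≡⟨ cong₂ _++_ (sym (map-∘ w)) (map-proj₂-labelled W) ⟩
  map id w ++ _                                    ≡⟨ cong (_++ _) (map-id w) ⟩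
  w ++ _                                           ∎
  where open ≡-Reasoning

map-proj₁-labelled : (W : Segmentation ps t) → map proj₁ (labelled W) ≡ expand (answerRuns W)
map-proj₁-labelled [] = refl
map-proj₁-labelled (segment {q = q} w _ W) = begin
  map proj₁ (map (label q) w ++ labelled W)              ≡⟨ map-++ proj₁ (map (label q) w) _ ⟩
  map proj₁ (map (label q) w) ++ map proj₁ (labelled W)  ≡⟨ cong₂ _++_ (sym (map-∘ w)) (map-proj₁-labelled W) ⟩
  map (const q) w ++ expand (answerRuns W)            ≡⟨ cong (_++ _) (map-const q w) ⟩
  replicate (length w) q ++ expand (answerRuns W)     ∎
  where open ≡-Reasoning

map-proj₁-answerRuns : (W : Segmentation ps t) → map proj₁ (answerRuns W) ≡ map asked ps
map-proj₁-answerRuns [] = refl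
map-proj₁-answerRuns (segment w _ W) = cong (_ ∷_) (map-proj₁-answerRuns W)

Segmentation-++ : ∀ {ps′ t′} → Segmentation ps t → Segmentation ps′ t′ → Segmentation (ps ++ ps′) (t ++ t′)
Segmentation-++ [] W′ = W′
Segmentation-++ (segment {t = t} w e W) W′ = subst (Segmentation _) (sym (++-assoc w t _)) (segment w e (Segmentation-++ W W′))

yesValue : Bool → ℕ → ℕ
yesValue q x = (x + [ if q then false else true ]) ⊓ 4

noValue : Bool → ℕ → ℕ
noValue q x = (x + [ q ]) ⊓ 4

StaysOutside : (Bool → ℕ → ℕ) → Set
StaysOutside f = ∀ q x → inSupport x ≡ false → inSupport (f q x) ≡ false

capped-outside : ∀ x k → inSupport x ≡ false → inSupport ((x + k) ⊓ 4) ≡ false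
capped-outside (suc (suc (suc (suc x)))) k _ = refl

yesValue-outside : StaysOutside yesValue
yesValue-outside q x = capped-outside x _

noValue-outside : StaysOutside noValue
noValue-outside q x = capped-outside x _

updatedRuns : (Bool → ℕ → ℕ) → List Piece → List (ℕ × ℕ)
updatedRuns f = map λ p → f (asked p) (value p) , size p

expand-supportRuns-∷ : ∀ x n rs →
  expand (supportRuns ((x , n) ∷ rs)) ≡ (if inSupport x then replicate n x else []) ++ expand (supportRuns rs)
expand-supportRuns-∷ x n rs with inSupport x
... | true = refl
... | false = refl

filter-update-segment : (f : Bool → ℕ → ℕ) → StaysOutside f → ∀ q {n v} (w : List ℕ) →
  filterᵇ inSupport w ≡ replicate n v →
  filterᵇ inSupport (map (uncurry f) (map (label q) w)) ≡ (if inSupport (f q v) then replicate n (f q v) else [])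
filter-update-segment f out q {n} {v} w e = begin
  filterᵇ inSupport (map (uncurry f) (map (label q) w))         ≡⟨ cong (filterᵇ inSupport) (sym (map-∘ w)) ⟩
  filterᵇ inSupport (map (f q) w)                            ≡⟨ filterᵇ-map-filterᵇ inSupport (f q) inSupport (out q) w ⟩
  filterᵇ inSupport (map (f q) (filterᵇ inSupport w))        ≡⟨ cong (λ xs → filterᵇ inSupport (map (f q) xs)) e ⟩
  filterᵇ inSupport (map (f q) (replicate n v))              ≡⟨ cong (filterᵇ inSupport) (map-replicate (f q) n v) ⟩
  filterᵇ inSupport (replicate n (f q v))                    ≡⟨ filterᵇ-replicate inSupport n (f q v) ⟩
  (if inSupport (f q v) then replicate n (f q v) else [])   ∎
  where open ≡-Reasoning

filter-update : (f : Bool → ℕ → ℕ) → StaysOutside f → (W : Segmentation ps t) →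
  filterᵇ inSupport (map (uncurry f) (labelled W)) ≡ expand (supportRuns (updatedRuns f ps))
filter-update f out [] = refl
filter-update f out (segment {v = v} {q} {n} {ps} w e W) = begin
  filterᵇ inSupport (map (uncurry f) (map (label q) w ++ labelled W))
    ≡⟨ cong (filterᵇ inSupport) (map-++ (uncurry f) (map (label q) w) _) ⟩
  filterᵇ inSupport (map (uncurry f) (map (label q) w) ++ map (uncurry f) (labelled W))
    ≡⟨ filter-++ (T? ∘ inSupport) (map (uncurry f) (map (label q) w)) _ ⟩
  filterᵇ inSupport (map (uncurry f) (map (label q) w)) ++ filterᵇ inSupport (map (uncurry f) (labelled W))
    ≡⟨ cong₂ _++_ (filter-update-segment f out q w e) (filter-update f out W) ⟩
  (if inSupport (f q v) then replicate n (f q v) else []) ++ expand (supportRuns (updatedRuns f ps))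
    ≡⟨ sym (expand-supportRuns-∷ (f q v) n _) ⟩
  expand (supportRuns (updatedRuns f (piece v q n ∷ ps)))  ∎
  where open ≡-Reasoning

askedWith : ℕ → Bool × ℕ → Bool
askedWith i (q , x) = if q then x ≡ᵇ i else false

askedCount : ℕ → List Piece → ℕ
askedCount i [] = 0
askedCount i (piece v q n ∷ ps) = (if askedWith i (q , v) then n else 0) + askedCount i ps

askedCount-++ : ∀ i ps ps′ → askedCount i (ps ++ ps′) ≡ askedCount i ps + askedCount i ps′
askedCount-++ i [] ps′ = refl
askedCount-++ i (piece v q n ∷ ps) ps′ =
  trans (cong (_ +_) (askedCount-++ i ps ps′)) (sym (+-assoc (if askedWith i (q , v) then n else 0) _ _))

length-filter-askedWith-segment : ∀ i → inSupport i ≡ true → ∀ q {n v} (w : List ℕ) →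
  filterᵇ inSupport w ≡ replicate n v →
  length (filterᵇ (askedWith i) (map (label q) w)) ≡ (if askedWith i (q , v) then n else 0)
length-filter-askedWith-segment i hi false w e = cong length (begin
  filterᵇ (askedWith i) (map (label false) w)        ≡⟨ filter-map (T? ∘ askedWith i) (label false) w ⟩
  map (label false) (filterᵇ (const false) w)        ≡⟨ cong (map (label false)) (filterᵇ-const-false w) ⟩
  []                                              ∎)
  where open ≡-Reasoning
length-filter-askedWith-segment i hi true {n} {v} w e = begin
  length (filterᵇ (askedWith i) (map (label true) w)) ≡⟨ cong length (filter-map (T? ∘ askedWith i) (label true) w) ⟩
  length (map (label true) (filterᵇ (_≡ᵇ i) w))       ≡⟨ length-map (label true) (filterᵇ (_≡ᵇ i) w) ⟩
  countOf i w                                     ≡⟨ countOf-support i hi w ⟩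
  countOf i (filterᵇ inSupport w)                 ≡⟨ cong (countOf i) e ⟩
  countOf i (replicate n v)                       ≡⟨ countOf-replicate i n v ⟩
  (if v ≡ᵇ i then n else 0)                       ∎
  where open ≡-Reasoning

length-filter-askedWith : ∀ i → inSupport i ≡ true → (W : Segmentation ps t) →
  length (filterᵇ (askedWith i) (labelled W)) ≡ askedCount i ps
length-filter-askedWith i hi [] = refl
length-filter-askedWith i hi (segment {q = q} w e W) = begin
  length (filterᵇ (askedWith i) (map (label q) w ++ labelled W))
    ≡⟨ cong length (filter-++ (T? ∘ askedWith i) (map (label q) w) _) ⟩
  length (filterᵇ (askedWith i) (map (label q) w) ++ filterᵇ (askedWith i) (labelled W))
    ≡⟨ length-++ (filterᵇ (askedWith i) (map (label q) w)) ⟩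
  length (filterᵇ (askedWith i) (map (label q) w)) + length (filterᵇ (askedWith i) (labelled W))
    ≡⟨ cong₂ _+_ (length-filter-askedWith-segment i hi q w e) (length-filter-askedWith i hi W) ⟩
  _ ∎
  where open ≡-Reasoning

-- Runs and allotments

data Cut : Set where
  prefix suffix : Cut

data Mode : Set where
  none whole : Mode
  part : Cut → Mode

taken : Mode → ℕ → ℕ → ℕ
taken none n a = 0
taken whole n a = n
taken (part _) n a = a

record Run : Set where
  constructor run
  field
    value : ℕ
    size : ℕ
    mode : Mode
    amount : ℕ

runPieces : Run → List Piece
runPieces (run v n none a) = piece v false n ∷ []
runPieces (run v n whole a) = piece v true n ∷ []
runPieces (run v n (part prefix) a) = piece v true a ∷ piece v false (n ∸ a) ∷ []
runPieces (run v n (part suffix) a) = piece v false (n ∸ a) ∷ piece v true a ∷ []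

ValidRun : Run → Set
ValidRun r = Run.amount r ≤ Run.size r

single-segment : ∀ {v n} q (w : List ℕ) → filterᵇ inSupport w ≡ replicate n v → Segmentation (piece v q n ∷ []) w
single-segment q w e = subst (Segmentation _) (++-identityʳ w) (segment w e [])

two-segments : ∀ {v m n} q q′ (w : List ℕ) → filterᵇ inSupport w ≡ replicate m v ++ replicate n v →
  Segmentation (piece v q m ∷ piece v q′ n ∷ []) w
two-segments q q′ w e with u , u′ , refl , e₁ , e₂ ← filter-++⁻ (T? ∘ inSupport) w _ _ e =
  segment u e₁ (single-segment q′ u′ e₂)

segmentRun : (r : Run) → ValidRun r → (w : List ℕ) →
  filterᵇ inSupport w ≡ replicate (Run.size r) (Run.value r) → Segmentation (runPieces r) w
segmentRun (run v n none a) a≤n w e = single-segment false w e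
segmentRun (run v n whole a) a≤n w e = single-segment true w e
segmentRun (run v n (part prefix) a) a≤n w e =
  two-segments true false w (trans e (trans (cong (λ k → replicate k v) (sym (m+[n∸m]≡n a≤n))) (replicate-+ a (n ∸ a) v)))
segmentRun (run v n (part suffix) a) a≤n w e =
  two-segments false true w (trans e (trans (cong (λ k → replicate k v) (sym (m∸n+n≡m a≤n))) (replicate-+ (n ∸ a) a v)))

runValues : List Run → List (ℕ × ℕ)
runValues = map λ r → Run.value r , Run.size r

segmentRuns : ∀ r rs → All ValidRun (r ∷ rs) → filterᵇ inSupport t ≡ expand (runValues (r ∷ rs)) →
  Segmentation (concatMap runPieces (r ∷ rs)) t
segmentRuns r [] (ok ∷ []) e =
  subst (λ ps → Segmentation ps _) (sym (++-identityʳ _)) (segmentRun r ok _ (trans e (++-identityʳ _)))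
segmentRuns {t = t} r (r′ ∷ rs) (ok ∷ oks) e with u , u′ , refl , e₁ , e₂ ← filter-++⁻ (T? ∘ inSupport) t _ _ e =
  Segmentation-++ (segmentRun r ok u e₁) (segmentRuns r′ rs oks e₂)

askedByRuns : ℕ → List Run → ℕ
askedByRuns i [] = 0
askedByRuns i (run v n m a ∷ rs) = (if v ≡ᵇ i then taken m n a else 0) + askedByRuns i rs

askedCount-runPieces : ∀ i r → askedCount i (runPieces r) ≡ askedByRuns i (r ∷ [])
askedCount-runPieces i (run v n none a) with v ≡ᵇ i
... | true = refl
... | false = refl
askedCount-runPieces i (run v n whole a) = refl
askedCount-runPieces i (run v n (part prefix) a) = refl
askedCount-runPieces i (run v n (part suffix) a) = refl

askedCount-runs : ∀ i rs → askedCount i (concatMap runPieces rs) ≡ askedByRuns i rs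
askedCount-runs i [] = refl
askedCount-runs i (r@(run v n m a) ∷ rs) = begin
  askedCount i (runPieces r ++ concatMap runPieces rs)
    ≡⟨ askedCount-++ i (runPieces r) _ ⟩
  askedCount i (runPieces r) + askedCount i (concatMap runPieces rs)
    ≡⟨ cong₂ _+_ (askedCount-runPieces i r) (askedCount-runs i rs) ⟩
  askedByRuns i (r ∷ []) + askedByRuns i rs
    ≡⟨ cong (_+ _) (+-identityʳ (if v ≡ᵇ i then taken m n a else 0)) ⟩
  askedByRuns i (r ∷ rs) ∎
  where open ≡-Reasoning

takenAt : Vec Mode k → Vec ℕ k → Vec ℕ k → Fin k → ℕ
takenAt ms ns as i = taken (lookup ms i) (lookup ns i) (lookup as i)

-- Stated through lookups so that it unfolds on vectors of known length with unknown entries.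
takenAll : Vec Mode k → Vec ℕ k → Vec ℕ k → ℕ
takenAll ms ns as = sum (Vec.tabulate (takenAt ms ns as))

record Allotment (modes : Vec Mode k) (sizes : Vec ℕ k) (c : ℕ) : Set where
  constructor allot
  field
    amounts : Vec ℕ k
    amounts≤sizes : Pointwise _≤_ amounts sizes
    total : takenAll modes sizes amounts ≡ c

greedyModes : Vec Cut k → Fin k → Vec Mode k
greedyModes (cut ∷ cuts) zero = part cut ∷ Vec.replicate _ none
greedyModes (cut ∷ cuts) (suc j) = whole ∷ greedyModes cuts j

-- Index zero asks a prefix of the first run only; the others fill the remaining runs greedily.
halvingModes : Vec Cut k → Fin (suc k) → Vec Mode (suc k)
halvingModes cuts zero = part prefix ∷ Vec.replicate _ none
halvingModes cuts (suc j) = none ∷ greedyModes cuts j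

takenAll-none : (ns as : Vec ℕ k) → takenAll (Vec.replicate k none) ns as ≡ 0
takenAll-none [] [] = refl
takenAll-none (n ∷ ns) (a ∷ as) = takenAll-none ns as

zeros≤ : (ns : Vec ℕ k) → Pointwise _≤_ (Vec.replicate k 0) ns
zeros≤ [] = []
zeros≤ (n ∷ ns) = z≤n ∷ zeros≤ ns

allot-first : ∀ cut {n} (ns : Vec ℕ k) → c ≤ n → Allotment (part cut ∷ Vec.replicate k none) (n ∷ ns) c
allot-first {c = c} cut ns c≤n = allot (c ∷ Vec.replicate _ 0) (c≤n ∷ zeros≤ ns)
  (trans (cong (c +_) (takenAll-none ns (Vec.replicate _ 0))) (+-identityʳ c))

greedy : (cuts : Vec Cut (suc k)) (ns : Vec ℕ (suc k)) → c ≤ sum ns → ∃ λ j → Allotment (greedyModes cuts j) ns c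
greedy {c = c} (cut ∷ cuts) (n ∷ ns) c≤ with c ≤? n
... | yes c≤n = zero , allot-first cut ns c≤n
greedy {c = c} (cut ∷ []) (n ∷ []) c≤ | no c≰n = contradiction (subst (c ≤_) (+-identityʳ n) c≤) c≰n
greedy {c = c} (cut ∷ cuts@(_ ∷ _)) (n ∷ ns) c≤ | no c≰n
  with j , allot as as≤ tot ← greedy cuts ns (m≤n+o⇒m∸n≤o c n c≤) =
  suc j , allot (0 ∷ as) (z≤n ∷ as≤) (trans (cong (n +_) tot) (m+[n∸m]≡n (≰⇒≥ c≰n)))

≤-half-rest : ∀ {m n} → c ≤ ⌈ m + n /2⌉ → m < c → c ≤ n
≤-half-rest {c} {m} {n} c≤ m<c = +-cancelˡ-≤ c c n (begin
  c + c                         ≤⟨ +-mono-≤ c≤ c≤ ⟩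
  ⌈ m + n /2⌉ + ⌈ m + n /2⌉     ≤⟨ +-monoʳ-≤ ⌈ m + n /2⌉ (⌊n/2⌋≤⌈n/2⌉ (suc (m + n))) ⟩
  ⌈ m + n /2⌉ + ⌈ suc (m + n) /2⌉ ≡⟨ ⌊n/2⌋+⌈n/2⌉≡n (suc (m + n)) ⟩
  suc m + n                     ≤⟨ +-monoˡ-≤ n m<c ⟩
  c + n                         ∎)
  where open ≤-Reasoning

halving : (cuts : Vec Cut (suc k)) (n : ℕ) (ns : Vec ℕ (suc k)) → c ≤ ⌈ n + sum ns /2⌉ →
  ∃ λ j → Allotment (halvingModes cuts j) (n ∷ ns) c
halving {c = c} cuts n ns c≤ with c ≤? sum ns
... | yes c≤ns with j , allot as as≤ tot ← greedy cuts ns c≤ns = suc j , allot (0 ∷ as) (z≤n ∷ as≤) tot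
... | no c≰ns = zero , allot-first prefix ns
  (≤-half-rest (subst (λ x → c ≤ ⌈ x /2⌉) (+-comm n (sum ns)) c≤) (≰⇒> c≰ns))

-- Cyclic offsets

[m%d+n]%d≡[m+n]%d : ∀ m n d .{{_ : NonZero d}} → (m % d + n) % d ≡ (m + n) % d
[m%d+n]%d≡[m+n]%d m n d = begin
  (m % d + n) % d             ≡⟨ %-distribˡ-+ (m % d) n d ⟩
  (m % d % d + n % d) % d     ≡⟨ cong (λ x → (x + n % d) % d) (m%n%n≡m%n m d) ⟩
  (m % d + n % d) % d         ≡⟨ sym (%-distribˡ-+ m n d) ⟩
  (m + n) % d                 ∎
  where open ≡-Reasoning

[m+n%d]%d≡[m+n]%d : ∀ m n d .{{_ : NonZero d}} → (m + n % d) % d ≡ (m + n) % d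
[m+n%d]%d≡[m+n]%d m n d = begin
  (m + n % d) % d   ≡⟨ cong (_% d) (+-comm m (n % d)) ⟩
  (n % d + m) % d   ≡⟨ [m%d+n]%d≡[m+n]%d n m d ⟩
  (n + m) % d       ≡⟨ cong (_% d) (+-comm n m) ⟩
  (m + n) % d       ∎
  where open ≡-Reasoning

≰ᵇ⇒> : ∀ {x n} → (x ≤ᵇ n) ≡ false → n < x
≰ᵇ⇒> {x} {n} eq = ≰⇒> λ x≤n → subst T eq (≤⇒≤ᵇ x≤n)

module Cyclic (N : ℕ) .{{_ : NonZero N}} where

  -- Defs.offset, on the underlying numbers.
  cyclicOffset : ℕ → ℕ → ℕ
  cyclicOffset x n = if x ≤ᵇ n then n ∸ x else (n + N) ∸ x

  cyclicOffset<N : ∀ x {n} → n < N → cyclicOffset x n < N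
  cyclicOffset<N x {n} n<N with x ≤ᵇ n in eq
  ... | true = ≤-<-trans (m∸n≤m n x) n<N
  ... | false = m<n+o⇒m∸n<o (n + N) x (+-monoˡ-< N (≰ᵇ⇒> eq))

  +-cyclicOffset : ∀ {x n} → x ≤ N → n < N → (x + cyclicOffset x n) % N ≡ n
  +-cyclicOffset {x} {n} x≤N n<N with x ≤ᵇ n in eq
  ... | true = trans (cong (_% N) (m+[n∸m]≡n (≤ᵇ⇒≤ x n (subst T (sym eq) _)))) (m<n⇒m%n≡m n<N)
  ... | false = begin
    (x + ((n + N) ∸ x)) % N  ≡⟨ cong (_% N) (m+[n∸m]≡n (≤-trans x≤N (m≤n+m N n))) ⟩
    (n + N) % N              ≡⟨ [m+n]%n≡m%n n N ⟩
    n % N                    ≡⟨ m<n⇒m%n≡m n<N ⟩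
    n                        ∎
    where open ≡-Reasoning

  shift-back : ∀ {x d} → x ≤ N → d < N → d ≡ ((N ∸ x) + (x + d) % N) % N
  shift-back {x} {d} x≤N d<N = sym (begin
    ((N ∸ x) + (x + d) % N) % N  ≡⟨ [m+n%d]%d≡[m+n]%d (N ∸ x) (x + d) N ⟩
    ((N ∸ x) + (x + d)) % N      ≡⟨ cong (_% N) (sym (+-assoc (N ∸ x) x d)) ⟩
    ((N ∸ x) + x + d) % N        ≡⟨ cong (λ y → (y + d) % N) (m∸n+n≡m x≤N) ⟩
    (N + d) % N                  ≡⟨ cong (_% N) (+-comm N d) ⟩
    (d + N) % N                  ≡⟨ [m+n]%n≡m%n d N ⟩
    d % N                        ≡⟨ m<n⇒m%n≡m d<N ⟩
    d                            ∎)
    where open ≡-Reasoning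

  cyclicOffset-unique : ∀ {x n d} → x ≤ N → n < N → d < N → (x + d) % N ≡ n → cyclicOffset x n ≡ d
  cyclicOffset-unique {x} {n} {d} x≤N n<N d<N e = begin
    cyclicOffset x n                                    ≡⟨ shift-back x≤N (cyclicOffset<N x n<N) ⟩
    ((N ∸ x) + (x + cyclicOffset x n) % N) % N          ≡⟨ cong (λ y → ((N ∸ x) + y) % N) (trans (+-cyclicOffset x≤N n<N) (sym e)) ⟩
    ((N ∸ x) + (x + d) % N) % N                         ≡⟨ sym (shift-back x≤N d<N) ⟩
    d                                                   ∎
    where open ≡-Reasoning

  cyclicOffset-shift : ∀ {r p n} → r ≤ N → p ≤ N → n < N →
    cyclicOffset ((r + p) % N) n ≡ cyclicOffset p (cyclicOffset r n)
  cyclicOffset-shift {r} {p} {n} r≤N p≤N n<N =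
    cyclicOffset-unique (m%n≤n (r + p) N) n<N (cyclicOffset<N p i<N) (begin
      ((r + p) % N + d) % N   ≡⟨ [m%d+n]%d≡[m+n]%d (r + p) d N ⟩
      (r + p + d) % N         ≡⟨ cong (_% N) (+-assoc r p d) ⟩
      (r + (p + d)) % N       ≡⟨ sym ([m+n%d]%d≡[m+n]%d r (p + d) N) ⟩
      (r + (p + d) % N) % N   ≡⟨ cong (λ y → (r + y) % N) (+-cyclicOffset p≤N i<N) ⟩
      (r + i) % N             ≡⟨ +-cyclicOffset r≤N n<N ⟩
      n                       ∎)
    where
    open ≡-Reasoning
    i = cyclicOffset r n
    d = cyclicOffset p i
    i<N : i < N
    i<N = cyclicOffset<N r n<N

  cyclicOffset-+ : ∀ x i → cyclicOffset x (x + i) ≡ i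
  cyclicOffset-+ x i with x ≤ᵇ x + i in eq
  ... | true = m+n∸m≡n x i
  ... | false = contradiction (m≤m+n x i) (λ le → subst T eq (≤⇒≤ᵇ le))

  cyclicOffset-wrap : ∀ {x i} → x ≤ N → i < x → cyclicOffset x i ≡ (N ∸ x) + i
  cyclicOffset-wrap {x} {i} x≤N i<x with x ≤ᵇ i in eq
  ... | true = contradiction (≤ᵇ⇒≤ x i (subst T (sym eq) _)) (<⇒≱ i<x)
  ... | false = trans (+-∸-assoc i x≤N) (+-comm i (N ∸ x))

  map-cyclicOffset-rotated : ∀ {r} → r ≤ N → map (cyclicOffset r) (rotation r (range 0 N)) ≡ range 0 N
  map-cyclicOffset-rotated {r} r≤N = begin
    map (cyclicOffset r) (rotation r (range 0 N))
      ≡⟨ cong (λ n → map (cyclicOffset r) (drop r (range 0 n) ++ take r (range 0 n))) N≡r+[N∸r] ⟩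
    map (cyclicOffset r) (drop r (range 0 (r + (N ∸ r))) ++ take r (range 0 (r + (N ∸ r))))
      ≡⟨ cong₂ (λ xs ys → map (cyclicOffset r) (xs ++ ys)) (drop-range 0 r (N ∸ r)) (take-range 0 r (N ∸ r)) ⟩
    map (cyclicOffset r) (range r (N ∸ r) ++ range 0 r)
      ≡⟨ map-++ (cyclicOffset r) (range r (N ∸ r)) (range 0 r) ⟩
    map (cyclicOffset r) (range r (N ∸ r)) ++ map (cyclicOffset r) (range 0 r)
      ≡⟨ cong₂ _++_ (map-range (cyclicOffset r) r 0 (N ∸ r) λ i _ → cyclicOffset-+ r i)
                    (map-range (cyclicOffset r) 0 (N ∸ r) r λ i i<r → cyclicOffset-wrap r≤N i<r) ⟩
    range 0 (N ∸ r) ++ range (N ∸ r) r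
      ≡⟨ sym (range-+ 0 (N ∸ r) r) ⟩
    range 0 (N ∸ r + r)
      ≡⟨ cong (range 0) (m∸n+n≡m r≤N) ⟩
    range 0 N ∎
    where
    open ≡-Reasoning
    N≡r+[N∸r] : N ≡ r + (N ∸ r)
    N≡r+[N∸r] = sym (m+[n∸m]≡n r≤N)

  positions : ∀ {r} → r ≤ N → map (cyclicOffset r ∘ toℕ) (rotation r (allFin N)) ≡ range 0 N
  positions {r} r≤N = begin
    map (cyclicOffset r ∘ toℕ) (rotation r (allFin N))         ≡⟨ map-∘ (rotation r (allFin N)) ⟩
    map (cyclicOffset r) (map toℕ (rotation r (allFin N)))     ≡⟨ cong (map (cyclicOffset r)) (map-rotation toℕ r (allFin N)) ⟩
    map (cyclicOffset r) (rotation r (map toℕ (allFin N)))     ≡⟨ cong (map (cyclicOffset r) ∘ rotation r) (map-toℕ-allFin N) ⟩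
    map (cyclicOffset r) (rotation r (range 0 N))              ≡⟨ map-cyclicOffset-rotated r≤N ⟩
    range 0 N                                                  ∎
    where open ≡-Reasoning

  cyclicOffset<⇔ : ∀ {p i} ℓ → p ≤ N → i < N →
    cyclicOffset p i < ℓ ⇔ ((p ≤ i × i < p + ℓ) ⊎ (i < p × i + N < p + ℓ))
  cyclicOffset<⇔ {p} {i} ℓ p≤N i<N with p ≤? i
  ... | yes p≤i = mk⇔ to from
    where
    off≡ : cyclicOffset p i ≡ i ∸ p
    off≡ = trans (cong (cyclicOffset p) (sym (m+[n∸m]≡n p≤i))) (cyclicOffset-+ p (i ∸ p))
    to : cyclicOffset p i < ℓ → (p ≤ i × i < p + ℓ) ⊎ (i < p × i + N < p + ℓ)
    to lt = inj₁ (p≤i , subst (_< p + ℓ) (m+[n∸m]≡n p≤i) (+-monoʳ-< p (subst (_< ℓ) off≡ lt)))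
    from : (p ≤ i × i < p + ℓ) ⊎ (i < p × i + N < p + ℓ) → cyclicOffset p i < ℓ
    from (inj₁ (_ , lt)) = subst (_< ℓ) (sym off≡) (subst (i ∸ p <_) (m+n∸m≡n p ℓ) (∸-monoˡ-< lt p≤i))
    from (inj₂ (i<p , _)) = contradiction p≤i (<⇒≱ i<p)
  ... | no p≰i = mk⇔ to from
    where
    i<p = ≰⇒> p≰i
    off≡ : cyclicOffset p i ≡ (N ∸ p) + i
    off≡ = cyclicOffset-wrap p≤N i<p
    shift : (N ∸ p) + i + p ≡ i + N
    shift = trans (+-assoc (N ∸ p) i p) (trans (cong ((N ∸ p) +_) (+-comm i p))
      (trans (sym (+-assoc (N ∸ p) p i)) (trans (cong (_+ i) (m∸n+n≡m p≤N)) (+-comm N i))))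
    to : cyclicOffset p i < ℓ → (p ≤ i × i < p + ℓ) ⊎ (i < p × i + N < p + ℓ)
    to lt = inj₂ (i<p , subst₂ _<_ shift (+-comm ℓ p) (+-monoˡ-< p (subst (_< ℓ) off≡ lt)))
    from : (p ≤ i × i < p + ℓ) ⊎ (i < p × i + N < p + ℓ) → cyclicOffset p i < ℓ
    from (inj₁ (p≤i , _)) = contradiction p≤i p≰i
    from (inj₂ (_ , lt)) = subst (_< ℓ) (sym off≡) (+-cancelʳ-< p _ ℓ (subst₂ _<_ (sym shift) (+-comm p ℓ) lt))

-- Four-interval questions

InTrueRun : List (Bool × ℕ) → ℕ → ℕ → Set
InTrueRun [] p i = ⊥
InTrueRun ((b , n) ∷ rs) p i = (T b × p ≤ i × i < p + n) ⊎ InTrueRun rs (p + n) i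

inTrueRun? : ∀ rs p i → Dec (InTrueRun rs p i)
inTrueRun? [] p i = no λ ()
inTrueRun? ((b , n) ∷ rs) p i = (T? b ×-dec (p ≤? i ×-dec i <? p + n)) ⊎-dec inTrueRun? rs (p + n) i

InTrueRun-< : ∀ rs {p i} → i < p → ¬ InTrueRun rs p i
InTrueRun-< ((b , n) ∷ rs) i<p (inj₁ (_ , p≤i , _)) = <⇒≱ i<p p≤i
InTrueRun-< ((b , n) ∷ rs) i<p (inj₂ h) = InTrueRun-< rs (<-≤-trans i<p (m≤m+n _ n)) h

map-inTrueRun-range : ∀ rs p → map (λ i → does (inTrueRun? rs p i)) (range p (length (expand rs))) ≡ expand rs
map-inTrueRun-range [] p = refl
map-inTrueRun-range ((b , n) ∷ rs) p = begin
  map inRuns (range p (length (replicate n b ++ expand rs)))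
    ≡⟨ cong (λ l → map inRuns (range p l)) (trans (length-++ (replicate n b)) (cong (_+ _) (length-replicate n))) ⟩
  map inRuns (range p (n + length (expand rs)))
    ≡⟨ cong (map inRuns) (range-+ p n _) ⟩
  map inRuns (range p n ++ range (p + n) (length (expand rs)))
    ≡⟨ map-++ inRuns (range p n) _ ⟩
  map inRuns (range p n) ++ map inRuns (range (p + n) (length (expand rs)))
    ≡⟨ cong₂ _++_ (map-range-const inRuns p n inside) (map-range-cong inRuns _ (p + n) _ beyond) ⟩
  replicate n b ++ map (λ i → does (inTrueRun? rs (p + n) i)) (range (p + n) (length (expand rs)))
    ≡⟨ cong (replicate n b ++_) (map-inTrueRun-range rs (p + n)) ⟩
  replicate n b ++ expand rs ∎
  where
  open ≡-Reasoning
  inRuns = λ i → does (inTrueRun? ((b , n) ∷ rs) p i)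
  inside : ∀ j → j < n → inRuns (p + j) ≡ b
  inside j j<n = does-⇔ (mk⇔ to from) (inTrueRun? ((b , n) ∷ rs) p (p + j)) (T? b)
    where
    to : InTrueRun ((b , n) ∷ rs) p (p + j) → T b
    to (inj₁ (tb , _)) = tb
    to (inj₂ h) = contradiction h (InTrueRun-< rs (+-monoʳ-< p j<n))
    from : T b → InTrueRun ((b , n) ∷ rs) p (p + j)
    from tb = inj₁ (tb , m≤m+n p j , +-monoʳ-< p j<n)
  beyond : ∀ j → j < length (expand rs) → inRuns (p + n + j) ≡ does (inTrueRun? rs (p + n) (p + n + j))
  beyond j _ = does-⇔ (mk⇔ to inj₂) (inTrueRun? ((b , n) ∷ rs) p _) (inTrueRun? rs (p + n) _)
    where
    to : InTrueRun ((b , n) ∷ rs) p (p + n + j) → InTrueRun rs (p + n) (p + n + j)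
    to (inj₁ (_ , _ , lt)) = contradiction (m≤m+n (p + n) j) (<⇒≱ lt)
    to (inj₂ h) = h

does≡true⇔ : (a? : Dec A) → does a? ≡ true ⇔ A
does≡true⇔ (yes a) = mk⇔ (const a) (const refl)
does≡true⇔ (no ¬a) = mk⇔ (λ ()) (λ a → contradiction a ¬a)

sum-left-nested₉ : ∀ a₀ a₁ a₂ a₃ a₄ a₅ a₆ a₇ a₈ →
  a₀ + a₁ + a₂ + a₃ + a₄ + a₅ + a₆ + a₇ + a₈ ≡ a₀ + (a₁ + (a₂ + (a₃ + (a₄ + (a₅ + (a₆ + (a₇ + (a₈ + 0))))))))
sum-left-nested₉ = solve-∀

alternating : Vec Bool 9
alternating = true ∷ false ∷ true ∷ false ∷ true ∷ false ∷ true ∷ false ∷ true ∷ []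

module IntervalQuestion (m : ℕ) {r : ℕ} (r≤N : r ≤ 2 ^ m) (a₀ a₁ a₂ a₃ a₄ a₅ a₆ a₇ a₈ : ℕ)
         (sum≡N : sum (a₀ ∷ a₁ ∷ a₂ ∷ a₃ ∷ a₄ ∷ a₅ ∷ a₆ ∷ a₇ ∷ a₈ ∷ []) ≡ 2 ^ m) where

  private
    N = 2 ^ m
    instance
      N≢0 : NonZero N
      N≢0 = m^n≢0 2 m
    runs = runsOf alternating (a₀ ∷ a₁ ∷ a₂ ∷ a₃ ∷ a₄ ∷ a₅ ∷ a₆ ∷ a₇ ∷ a₈ ∷ [])

  open Cyclic N

  position : U m → ℕ
  position y = cyclicOffset r (toℕ y)

  position<N : ∀ y → position y < N
  position<N y = cyclicOffset<N r (toℕ<n y)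

  question : Question m
  question y = does (inTrueRun? runs 0 (position y))

  answers : map question (rotation r (allFin N)) ≡ expand runs
  answers = begin
    map question (rotation r (allFin N))              ≡⟨ map-∘ (rotation r (allFin N)) ⟩
    map inRuns (map position (rotation r (allFin N))) ≡⟨ cong (map inRuns) (positions r≤N) ⟩
    map inRuns (range 0 N)                            ≡⟨ cong (map inRuns ∘ range 0) (sym length≡N) ⟩
    map inRuns (range 0 (length (expand runs)))       ≡⟨ map-inTrueRun-range runs 0 ⟩
    expand runs                                       ∎
    where
    open ≡-Reasoning
    inRuns = λ i → does (inTrueRun? runs 0 i)
    length≡N : length (expand runs) ≡ N
    length≡N = trans (length-expand-runsOf alternating (a₀ ∷ a₁ ∷ a₂ ∷ a₃ ∷ a₄ ∷ a₅ ∷ a₆ ∷ a₇ ∷ a₈ ∷ [])) sum≡N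

  -- Pᵢ is the position at which the i-th stretch of `runs` starts.
  private
    P₂ = a₀ + a₁
    P₃ = P₂ + a₂
    P₄ = P₃ + a₃
    P₅ = P₄ + a₄
    P₆ = P₅ + a₅
    P₇ = P₆ + a₆
    P₈ = P₇ + a₇

    P₉≡N : P₈ + a₈ ≡ N
    P₉≡N = trans (sum-left-nested₉ a₀ a₁ a₂ a₃ a₄ a₅ a₆ a₇ a₈) sum≡N

    P₈≤N : P₈ ≤ N
    P₈≤N = subst (P₈ ≤_) P₉≡N (m≤m+n P₈ a₈)
    P₇≤N : P₇ ≤ N
    P₇≤N = ≤-trans (m≤m+n P₇ a₇) P₈≤N
    P₆≤N : P₆ ≤ N
    P₆≤N = ≤-trans (m≤m+n P₆ a₆) P₇≤N
    P₅≤N : P₅ ≤ N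
    P₅≤N = ≤-trans (m≤m+n P₅ a₅) P₆≤N
    P₄≤N : P₄ ≤ N
    P₄≤N = ≤-trans (m≤m+n P₄ a₄) P₅≤N
    P₃≤N : P₃ ≤ N
    P₃≤N = ≤-trans (m≤m+n P₃ a₃) P₄≤N

    a₀≤P₈ : a₀ ≤ P₈
    a₀≤P₈ = ≤-trans (m≤m+n a₀ a₁) (≤-trans (m≤m+n P₂ a₂) (≤-trans (m≤m+n P₃ a₃) (≤-trans (m≤m+n P₄ a₄)
      (≤-trans (m≤m+n P₅ a₅) (≤-trans (m≤m+n P₆ a₆) (m≤m+n P₇ a₇))))))

  start : ℕ → U m
  start p = fromℕ< (m%n<n (r + p) N)

  offset-start : ∀ {p} → p ≤ N → ∀ y → offset (start p) y ≡ cyclicOffset p (position y)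
  offset-start {p} p≤N y = trans (cong (λ x → cyclicOffset x (toℕ y)) (toℕ-fromℕ< (m%n<n (r + p) N)))
    (cyclicOffset-shift r≤N p≤N (toℕ<n y))

  -- The last asked stretch continues across the end of U into the first one.
  starts : Vec (U m) 4
  starts = start P₈ ∷ start P₂ ∷ start P₄ ∷ start P₆ ∷ []

  lengths : Vec ℕ 4
  lengths = a₈ + a₀ ∷ a₂ ∷ a₄ ∷ a₆ ∷ []

  lengths≤N : ∀ j → lookup lengths j ≤ N
  lengths≤N zero = subst (a₈ + a₀ ≤_) (trans (+-comm a₈ P₈) P₉≡N) (+-monoʳ-≤ a₈ a₀≤P₈)
  lengths≤N (suc zero) = ≤-trans (m≤n+m a₂ P₂) P₃≤N
  lengths≤N (suc (suc zero)) = ≤-trans (m≤n+m a₄ P₄) P₅≤N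
  lengths≤N (suc (suc (suc zero))) = ≤-trans (m≤n+m a₆ P₆) P₇≤N

  inInterval⇔ : ∀ {p} ℓ → p + ℓ ≤ N → ∀ y → InInterval (start p) ℓ y ⇔ (p ≤ position y × position y < p + ℓ)
  inInterval⇔ {p} ℓ p+ℓ≤N y = subst (λ o → o < ℓ ⇔ (p ≤ i × i < p + ℓ)) (sym (offset-start p≤N y))
    (⇔-trans (cyclicOffset<⇔ ℓ p≤N (position<N y)) (mk⇔ unwrap inj₁))
    where
    i = position y
    p≤N = ≤-trans (m≤m+n p ℓ) p+ℓ≤N
    unwrap : (p ≤ i × i < p + ℓ) ⊎ (i < p × i + N < p + ℓ) → p ≤ i × i < p + ℓ
    unwrap (inj₁ h) = h
    unwrap (inj₂ (_ , lt)) = contradiction (≤-trans p+ℓ≤N (m≤n+m N i)) (<⇒≱ lt)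

  inWrappedInterval⇔ : ∀ y → InInterval (start P₈) (a₈ + a₀) y ⇔ (P₈ ≤ position y ⊎ position y < a₀)
  inWrappedInterval⇔ y = subst (λ o → o < a₈ + a₀ ⇔ (P₈ ≤ i ⊎ i < a₀)) (sym (offset-start P₈≤N y))
    (⇔-trans (cyclicOffset<⇔ (a₈ + a₀) P₈≤N (position<N y)) (mk⇔ unwrap rewrap))
    where
    i = position y
    N+a₀ : P₈ + (a₈ + a₀) ≡ N + a₀
    N+a₀ = trans (sym (+-assoc P₈ a₈ a₀)) (cong (_+ a₀) P₉≡N)
    unwrap : (P₈ ≤ i × i < P₈ + (a₈ + a₀)) ⊎ (i < P₈ × i + N < P₈ + (a₈ + a₀)) → P₈ ≤ i ⊎ i < a₀
    unwrap (inj₁ (P₈≤i , _)) = inj₁ P₈≤i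
    unwrap (inj₂ (_ , lt)) = inj₂ (+-cancelʳ-< N i a₀ (subst (i + N <_) (trans N+a₀ (+-comm N a₀)) lt))
    rewrap : P₈ ≤ i ⊎ i < a₀ → (P₈ ≤ i × i < P₈ + (a₈ + a₀)) ⊎ (i < P₈ × i + N < P₈ + (a₈ + a₀))
    rewrap (inj₁ P₈≤i) =
      inj₁ (P₈≤i , <-≤-trans (subst (i <_) (sym P₉≡N) (position<N y)) (+-monoʳ-≤ P₈ (m≤m+n a₈ a₀)))
    rewrap (inj₂ i<a₀) =
      inj₂ (<-≤-trans i<a₀ a₀≤P₈ , subst (i + N <_) (trans (+-comm a₀ N) (sym N+a₀)) (+-monoˡ-< N i<a₀))

  inTrueRun⇔inInterval : ∀ y → InTrueRun runs 0 (position y) ⇔ ∃ λ j → InInterval (lookup starts j) (lookup lengths j) y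
  inTrueRun⇔inInterval y = mk⇔ to from
    where
    i = position y
    to : InTrueRun runs 0 i → ∃ λ j → InInterval (lookup starts j) (lookup lengths j) y
    to (inj₁ (_ , _ , i<a₀)) = zero , ⇔-from (inWrappedInterval⇔ y) (inj₂ i<a₀)
    to (inj₂ (inj₂ (inj₁ (_ , h)))) = suc zero , ⇔-from (inInterval⇔ a₂ P₃≤N y) h
    to (inj₂ (inj₂ (inj₂ (inj₂ (inj₁ (_ , h)))))) = suc (suc zero) , ⇔-from (inInterval⇔ a₄ P₅≤N y) h
    to (inj₂ (inj₂ (inj₂ (inj₂ (inj₂ (inj₂ (inj₁ (_ , h)))))))) = suc (suc (suc zero)) , ⇔-from (inInterval⇔ a₆ P₇≤N y) h
    to (inj₂ (inj₂ (inj₂ (inj₂ (inj₂ (inj₂ (inj₂ (inj₂ (inj₁ (_ , P₈≤i , _)))))))))) =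
      zero , ⇔-from (inWrappedInterval⇔ y) (inj₁ P₈≤i)
    from : (∃ λ j → InInterval (lookup starts j) (lookup lengths j) y) → InTrueRun runs 0 i
    from (zero , h) with ⇔-to (inWrappedInterval⇔ y) h
    ... | inj₁ P₈≤i =
      inj₂ (inj₂ (inj₂ (inj₂ (inj₂ (inj₂ (inj₂ (inj₂ (inj₁ (_ , P₈≤i , subst (i <_) (sym P₉≡N) (position<N y))))))))))
    ... | inj₂ i<a₀ = inj₁ (_ , z≤n , i<a₀)
    from (suc zero , h) = inj₂ (inj₂ (inj₁ (_ , ⇔-to (inInterval⇔ a₂ P₃≤N y) h)))
    from (suc (suc zero) , h) = inj₂ (inj₂ (inj₂ (inj₂ (inj₁ (_ , ⇔-to (inInterval⇔ a₄ P₅≤N y) h)))))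
    from (suc (suc (suc zero)) , h) = inj₂ (inj₂ (inj₂ (inj₂ (inj₂ (inj₂ (inj₁ (_ , ⇔-to (inInterval⇔ a₆ P₇≤N y) h)))))))

  fourInterval : FourInterval m question
  fourInterval = starts , lengths , lengths≤N ,
    λ y → ⇔-trans (does≡true⇔ (inTrueRun? runs 0 (position y))) (inTrueRun⇔inInterval y)

intervalQuestion : ∀ m {r} → r ≤ 2 ^ m → (a : Vec ℕ 9) → sum a ≡ 2 ^ m →
  Σ (Question m) λ Q → FourInterval m Q × map Q (rotation r (allFin (2 ^ m))) ≡ expand (runsOf alternating a)
intervalQuestion m r≤N (a₀ ∷ a₁ ∷ a₂ ∷ a₃ ∷ a₄ ∷ a₅ ∷ a₆ ∷ a₇ ∷ a₈ ∷ []) sum≡N = question , fourInterval , answers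
  where open IntervalQuestion m r≤N a₀ a₁ a₂ a₃ a₄ a₅ a₆ a₇ a₈ sum≡N

-- Questions from segmentations

Admissible : List Piece → Set
Admissible ps =
  T (Bool-Embedding.embeds (map asked ps) alternating) ×
  CyclicallyShaped (supportRuns (updatedRuns yesValue ps)) × CyclicallyShaped (supportRuns (updatedRuns noValue ps))

admissible? : (ps : List Piece) → Dec (Admissible ps)
admissible? ps = T? _ ×-dec cyclicallyShaped? _ ×-dec cyclicallyShaped? _

WellShapedQuestion : ∀ m → StateFn m → ℕ → ℕ → ℕ → Set
WellShapedQuestion m σ b c d = Σ (Question m) λ Q →
  FourInterval m Q ×
  qcount m σ Q 0 ≡ 0 × qcount m σ Q 1 ≡ b × qcount m σ Q 2 ≡ c × qcount m σ Q 3 ≡ d ×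
  WellShaped m (σyes m σ Q) × WellShaped m (σno m σ Q)

module _ (m : ℕ) (σ : StateFn m) (Q : Question m) {ps t} (W : Segmentation ps t)
         (labelled-↻ : map (λ y → Q y , σ y) (allFin (2 ^ m)) ↻ labelled W) where

  private
    g : U m → Bool × ℕ
    g y = Q y , σ y

  qcount-segmentation : ∀ i → inSupport i ≡ true → qcount m σ Q i ≡ askedCount i ps
  qcount-segmentation i hi = begin
    length (filterᵇ (askedWith i ∘ g) all)         ≡⟨ sym (length-map g (filterᵇ (askedWith i ∘ g) all)) ⟩
    length (map g (filterᵇ (askedWith i ∘ g) all)) ≡⟨ cong length (sym (filter-map (T? ∘ askedWith i) g all)) ⟩
    length (filterᵇ (askedWith i) (map g all))     ≡⟨ ↻-length (↻-filter (T? ∘ askedWith i) labelled-↻) ⟩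
    length (filterᵇ (askedWith i) (labelled W))    ≡⟨ length-filter-askedWith i hi W ⟩
    askedCount i ps                                ∎
    where
    open ≡-Reasoning
    all = allFin (2 ^ m)

  wellShaped-answer : (f : Bool → ℕ → ℕ) → StaysOutside f → CyclicallyShaped (supportRuns (updatedRuns f ps)) →
    WellShaped m (λ y → f (Q y) (σ y))
  wellShaped-answer f out shaped = values⇒wellShaped m _ (wellShapedValues-↻ rotated
    (subst WellShapedValues (sym (filter-update f out W)) (cyclicallyShaped⇒wellShaped _ shaped)))
    where
    rotated : supportValues m (λ y → f (Q y) (σ y)) ↻ filterᵇ inSupport (map (uncurry f) (labelled W))
    rotated = subst (_↻ _)
      (trans (cong (filterᵇ inSupport) (sym (map-∘ (allFin (2 ^ m))))) (filter-map (T? ∘ inSupport) _ (allFin (2 ^ m))))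
      (↻-filter (T? ∘ inSupport) (↻-map (uncurry f) labelled-↻))

answerPattern : (W : Segmentation ps t) → T (Bool-Embedding.embeds (map asked ps) alternating) →
  ∃ λ a → expand (runsOf alternating a) ≡ map proj₁ (labelled W)
answerPattern W h with a , e ← Bool-Embedding.embeds-sound (answerRuns W) alternating
                                  (subst (λ bs → T (Bool-Embedding.embeds bs alternating)) (sym (map-proj₁-answerRuns W)) h) =
  a , trans e (sym (map-proj₁-labelled W))

sum-answerPattern : (W : Segmentation ps t) (a : Vec ℕ 9) → expand (runsOf alternating a) ≡ map proj₁ (labelled W) →
  sum a ≡ length t
sum-answerPattern {t = t} W a e = begin
  sum a                                   ≡⟨ sym (length-expand-runsOf alternating a) ⟩
  length (expand (runsOf alternating a))  ≡⟨ cong length e ⟩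
  length (map proj₁ (labelled W))         ≡⟨ length-map proj₁ (labelled W) ⟩
  length (labelled W)                     ≡⟨ sym (length-map proj₂ (labelled W)) ⟩
  length (map proj₂ (labelled W))         ≡⟨ cong length (map-proj₂-labelled W) ⟩
  length t                                ∎
  where open ≡-Reasoning

questionFromSegmentation : ∀ m (σ : StateFn m) {ps t} → map σ (allFin (2 ^ m)) ↻ t →
  (W : Segmentation ps t) → Admissible ps →
  Σ (Question m) λ Q → FourInterval m Q × (∀ i → inSupport i ≡ true → qcount m σ Q i ≡ askedCount i ps) ×
    WellShaped m (σyes m σ Q) × WellShaped m (σno m σ Q)
questionFromSegmentation m σ {ps} {t} σ-↻ W (answers-ok , yes-ok , no-ok)
  with r , r≤N , σ-rotated ← allFin-↻ σ σ-↻
  with a , a-pattern ← answerPattern W answers-ok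
  with Q , fourInterval , Q-rotated ← intervalQuestion m r≤N a
         (trans (sum-answerPattern W a a-pattern) (trans (cong length (sym σ-rotated)) (length-rotated σ r))) =
  Q , fourInterval , qcount-segmentation m σ Q W pairs-↻ ,
  wellShaped-answer m σ Q W pairs-↻ yesValue yesValue-outside yes-ok ,
  wellShaped-answer m σ Q W pairs-↻ noValue noValue-outside no-ok
  where
  pairs-↻ : map (λ y → Q y , σ y) (allFin (2 ^ m)) ↻ labelled W
  pairs-↻ = map-pair-↻ Q σ (allFin (2 ^ m)) r (labelled W)
    (trans Q-rotated a-pattern) (trans σ-rotated (sym (map-proj₂-labelled W)))

questionFromRuns : ∀ m (σ : StateFn m) {t r rs b c d} → map σ (allFin (2 ^ m)) ↻ t →
  All ValidRun (r ∷ rs) → filterᵇ inSupport t ≡ expand (runValues (r ∷ rs)) → Admissible (concatMap runPieces (r ∷ rs)) →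
  askedByRuns 0 (r ∷ rs) ≡ 0 → askedByRuns 1 (r ∷ rs) ≡ b → askedByRuns 2 (r ∷ rs) ≡ c → askedByRuns 3 (r ∷ rs) ≡ d →
  WellShapedQuestion m σ b c d
questionFromRuns m σ {r = r} {rs} σ-↻ valid fills admissible e₀ e₁ e₂ e₃
  with Q , fourInterval , counts , yes-shaped , no-shaped ←
         questionFromSegmentation m σ σ-↻ (segmentRuns r rs valid fills) admissible =
  Q , fourInterval , counted 0 refl e₀ , counted 1 refl e₁ , counted 2 refl e₂ , counted 3 refl e₃ , yes-shaped , no-shaped
  where
  counted : ∀ i {n} → inSupport i ≡ true → askedByRuns i (r ∷ rs) ≡ n → qcount m σ Q i ≡ n
  counted i hi e = trans (counts i hi) (trans (askedCount-runs i (r ∷ rs)) e)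

-- The two patterns

record Class (k : ℕ) : Set where
  constructor class
  field
    sizes : Vec ℕ k
    modes : Vec Mode k
    amounts : Vec ℕ k

classRun : ℕ → Class k → Fin k → Run
classRun v (class ns ms as) i = run v (lookup ns i) (lookup ms i) (lookup as i)

classTaken : Class k → ℕ
classTaken (class ns ms as) = takenAll ms ns as

classTakenAt : Class k → Fin k → ℕ
classTakenAt (class ns ms as) = takenAt ms ns as

data Slot : Set where
  one : Fin 2 → Slot
  two : Fin 5 → Slot
  three : Fin 3 → Slot

slotRun : Class 2 → Class 5 → Class 3 → Slot → Run
slotRun ones twos threes (one i) = classRun 1 ones i
slotRun ones twos threes (two i) = classRun 2 twos i
slotRun ones twos threes (three i) = classRun 3 threes i

slotEntry : Vec ℕ 2 → Vec ℕ 5 → Vec ℕ 3 → Slot → ℕ × ℕ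
slotEntry ons tns hns (one i) = 1 , lookup ons i
slotEntry ons tns hns (two i) = 2 , lookup tns i
slotEntry ons tns hns (three i) = 3 , lookup hns i

onesCuts : Vec Cut 1
onesCuts = prefix ∷ []

twosCuts : Vec Cut 4
twosCuts = prefix ∷ suffix ∷ prefix ∷ suffix ∷ []

threesCuts : Vec Cut 3
threesCuts = suffix ∷ suffix ∷ suffix ∷ []

configured : List Slot → (ons oas : Vec ℕ 2) (tns tas : Vec ℕ 5) (hns has : Vec ℕ 3) → Fin 2 → Fin 5 → Fin 3 → List Run
configured layout ons oas tns tas hns has j₁ j₂ j₃ = map (slotRun
  (class ons (halvingModes onesCuts j₁) oas) (class tns (halvingModes twosCuts j₂) tas) (class hns (greedyModes threesCuts j₃) has))
  layout

runValues-configured : ∀ layout ons oas tns tas hns has j₁ j₂ j₃ →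
  runValues (configured layout ons oas tns tas hns has j₁ j₂ j₃) ≡ map (slotEntry ons tns hns) layout
runValues-configured [] _ _ _ _ _ _ _ _ _ = refl
runValues-configured (one i ∷ layout) ons oas tns tas hns has j₁ j₂ j₃ =
  cong (_ ∷_) (runValues-configured layout ons oas tns tas hns has j₁ j₂ j₃)
runValues-configured (two i ∷ layout) ons oas tns tas hns has j₁ j₂ j₃ =
  cong (_ ∷_) (runValues-configured layout ons oas tns tas hns has j₁ j₂ j₃)
runValues-configured (three i ∷ layout) ons oas tns tas hns has j₁ j₂ j₃ =
  cong (_ ∷_) (runValues-configured layout ons oas tns tas hns has j₁ j₂ j₃)

valid-configured : ∀ layout {ons oas tns tas hns has} j₁ j₂ j₃ →
  Pointwise _≤_ oas ons → Pointwise _≤_ tas tns → Pointwise _≤_ has hns →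
  All ValidRun (configured layout ons oas tns tas hns has j₁ j₂ j₃)
valid-configured [] j₁ j₂ j₃ o t h = []
valid-configured (one i ∷ layout) j₁ j₂ j₃ o t h = Pointwise.lookup o i ∷ valid-configured layout j₁ j₂ j₃ o t h
valid-configured (two i ∷ layout) j₁ j₂ j₃ o t h = Pointwise.lookup t i ∷ valid-configured layout j₁ j₂ j₃ o t h
valid-configured (three i ∷ layout) j₁ j₂ j₃ o t h = Pointwise.lookup h i ∷ valid-configured layout j₁ j₂ j₃ o t h

AlwaysAdmissible : List Slot → Set
AlwaysAdmissible layout =
  ∀ ons oas tns tas hns has j₁ j₂ j₃ → Admissible (concatMap runPieces (configured layout ons oas tns tas hns has j₁ j₂ j₃))

CountsByClass : List Slot → Set
CountsByClass layout = ∀ ones twos threes → let runs = map (slotRun ones twos threes) layout in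
  askedByRuns 0 runs ≡ 0 × askedByRuns 1 runs ≡ classTaken ones ×
  askedByRuns 2 runs ≡ classTaken twos × askedByRuns 3 runs ≡ classTaken threes

questionFromLayout : ∀ m (σ : StateFn m) {xs} → map σ (allFin (2 ^ m)) ↻ xs →
  ∀ (layout : List⁺ Slot) → AlwaysAdmissible (toList layout) → CountsByClass (toList layout) →
  ∀ o os t ts hns {b c d} → filterᵇ inSupport xs ≡ expand (map (slotEntry (o ∷ os) (t ∷ ts) hns) (toList layout)) →
  b ≤ ⌈ o + sum os /2⌉ → c ≤ ⌈ t + sum ts /2⌉ → d ≤ sum hns → WellShapedQuestion m σ b c d
questionFromLayout m σ σ-↻ layout admissible counts o os t ts hns fills b≤ c≤ d≤
  with j₁ , allot oas oas≤ o-total ← halving onesCuts o os b≤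
  with j₂ , allot tas tas≤ t-total ← halving twosCuts t ts c≤
  with j₃ , allot has has≤ h-total ← greedy threesCuts hns d≤
  with e₀ , e₁ , e₂ , e₃ ← counts (class (o ∷ os) (halvingModes onesCuts j₁) oas)
                                  (class (t ∷ ts) (halvingModes twosCuts j₂) tas) (class hns (greedyModes threesCuts j₃) has) =
  questionFromRuns m σ σ-↻ (valid-configured (toList layout) j₁ j₂ j₃ oas≤ tas≤ has≤)
    (trans fills (cong expand (sym (runValues-configured (toList layout) (o ∷ os) oas (t ∷ ts) tas hns has j₁ j₂ j₃))))
    (admissible (o ∷ os) oas (t ∷ ts) tas hns has j₁ j₂ j₃)
    e₀ (trans e₁ o-total) (trans e₂ t-total) (trans e₃ h-total)

-- The runs of each pattern once its empty 0-block has been dropped; each value class lists its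
-- runs with the one used alone by halvingModes first.
layoutA : List⁺ Slot
layoutA = two (# 1) ∷ one (# 1) ∷ two (# 2) ∷ three (# 0) ∷ two (# 3) ∷
          one (# 0) ∷ two (# 4) ∷ three (# 1) ∷ two (# 0) ∷ three (# 2) ∷ []

layoutB : List⁺ Slot
layoutB = two (# 1) ∷ one (# 1) ∷ two (# 4) ∷ one (# 0) ∷ two (# 2) ∷
          three (# 0) ∷ two (# 3) ∷ three (# 1) ∷ two (# 0) ∷ three (# 2) ∷ []

-- By evaluation: admissibility only inspects the values and modes of the runs, so the unknown sizes
-- and amounts do not block the computation.
admissibleA : AlwaysAdmissible (toList layoutA)
admissibleA ons oas tns tas hns has = toWitness {a? = all? λ j₁ → all? λ j₂ → all? λ j₃ →
  admissible? (concatMap runPieces (configured (toList layoutA) ons oas tns tas hns has j₁ j₂ j₃))} tt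

admissibleB : AlwaysAdmissible (toList layoutB)
admissibleB ons oas tns tas hns has = toWitness {a? = all? λ j₁ → all? λ j₂ → all? λ j₃ →
  admissible? (concatMap runPieces (configured (toList layoutB) ons oas tns tas hns has j₁ j₂ j₃))} tt

sum-swap₂ : ∀ x₀ x₁ → x₁ + (x₀ + 0) ≡ x₀ + (x₁ + 0)
sum-swap₂ = solve-∀

sum-rotate₅ : ∀ x₀ x₁ x₂ x₃ x₄ → x₁ + (x₂ + (x₃ + (x₄ + (x₀ + 0)))) ≡ x₀ + (x₁ + (x₂ + (x₃ + (x₄ + 0))))
sum-rotate₅ = solve-∀

sum-permute₅ : ∀ x₀ x₁ x₂ x₃ x₄ → x₁ + (x₄ + (x₂ + (x₃ + (x₀ + 0)))) ≡ x₀ + (x₁ + (x₂ + (x₃ + (x₄ + 0))))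
sum-permute₅ = solve-∀

countsA : CountsByClass (toList layoutA)
countsA ones twos threes = refl , sum-swap₂ (o (# 0)) (o (# 1)) ,
  sum-rotate₅ (tw (# 0)) (tw (# 1)) (tw (# 2)) (tw (# 3)) (tw (# 4)) , refl
  where
  o = classTakenAt ones
  tw = classTakenAt twos

countsB : CountsByClass (toList layoutB)
countsB ones twos threes = refl , sum-swap₂ (o (# 0)) (o (# 1)) ,
  sum-permute₅ (tw (# 0)) (tw (# 1)) (tw (# 2)) (tw (# 3)) (tw (# 4)) , refl
  where
  o = classTakenAt ones
  tw = classTakenAt twos

PatternCase : Vec ℕ 12 → Set
PatternCase pat = ∀ m (σ : StateFn m) {xs} → map σ (allFin (2 ^ m)) ↻ xs → (lens : Vec ℕ 12) {b c d : ℕ} →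
  filterᵇ inSupport xs ≡ fill pat lens → occurrences 0 pat lens ≡ 0 →
  b ≤ ⌈ occurrences 1 pat lens /2⌉ → c ≤ ⌈ occurrences 2 pat lens /2⌉ → d ≤ occurrences 3 pat lens →
  WellShapedQuestion m σ b c d

patternCaseA : PatternCase patternA
patternCaseA m σ σ-↻ (l₀ ∷ l₁ ∷ l₂ ∷ l₃ ∷ l₄ ∷ l₅ ∷ l₆ ∷ l₇ ∷ l₈ ∷ l₉ ∷ l₁₀ ∷ l₁₁ ∷ []) {b} {c}
  fills no-zeros b≤ c≤ d≤ with refl ← trans (sym (+-identityʳ l₂)) no-zeros =
  questionFromLayout m σ σ-↻ layoutA admissibleA countsA
    l₇ (l₁ + l₃ ∷ []) l₁₀ (l₀ ∷ l₄ ∷ l₆ ∷ l₈ ∷ []) (l₅ ∷ l₉ ∷ l₁₁ ∷ [])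
    (trans fills (cong (replicate l₀ 2 ++_) (replicate-+-++ l₁ l₃ 1 _)))
    (subst (λ n → b ≤ ⌈ n /2⌉) (trans (sym (+-assoc l₁ l₃ _)) (sum-swap₂ l₇ (l₁ + l₃))) b≤)
    (subst (λ n → c ≤ ⌈ n /2⌉) (sum-rotate₅ l₁₀ l₀ l₄ l₆ l₈) c≤)
    d≤

patternCaseB : PatternCase patternB
patternCaseB m σ σ-↻ (l₀ ∷ l₁ ∷ l₂ ∷ l₃ ∷ l₄ ∷ l₅ ∷ l₆ ∷ l₇ ∷ l₈ ∷ l₉ ∷ l₁₀ ∷ l₁₁ ∷ []) {b} {c}
  fills no-zeros b≤ c≤ d≤ with refl ← trans (sym (+-identityʳ l₂)) no-zeros =
  questionFromLayout m σ σ-↻ layoutB admissibleB countsB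
    l₅ (l₁ + l₃ ∷ []) l₁₀ (l₀ ∷ l₆ ∷ l₈ ∷ l₄ ∷ []) (l₇ ∷ l₉ ∷ l₁₁ ∷ [])
    (trans fills (cong (replicate l₀ 2 ++_) (replicate-+-++ l₁ l₃ 1 _)))
    (subst (λ n → b ≤ ⌈ n /2⌉) (trans (sym (+-assoc l₁ l₃ _)) (sum-swap₂ l₅ (l₁ + l₃))) b≤)
    (subst (λ n → c ≤ ⌈ n /2⌉) (sum-permute₅ l₁₀ l₀ l₆ l₈ l₄) c≤)
    d≤

questionFromPattern : ∀ pat → PatternCase pat → ∀ m (σ : StateFn m) lens {b c d} → supportValues m σ ↻ fill pat lens →
  count m σ 0 ≡ 0 → b ≤ ⌈ count m σ 1 /2⌉ → c ≤ ⌈ count m σ 2 /2⌉ → d ≤ count m σ 3 → WellShapedQuestion m σ b c d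
questionFromPattern pat case m σ lens {b} {c} {d} shape no-zeros b≤ c≤ d≤
  with xs , σ-↻ , fills ← ↻-filter⁻ (T? ∘ inSupport) (subst (_↻ _) (supportValues≡ m σ) shape) =
  case m σ σ-↻ lens fills (trans (sym (counts 0 refl)) no-zeros)
    (subst (λ n → b ≤ ⌈ n /2⌉) (counts 1 refl) b≤) (subst (λ n → c ≤ ⌈ n /2⌉) (counts 2 refl) c≤)
    (subst (d ≤_) (counts 3 refl) d≤)
  where counts = count≡occurrences m σ {pat} {lens} shape

lemma3 : (m : ℕ) (σ : StateFn m) → IsState m σ → WellShaped m σ →
    count m σ 0 ≡ 0 →
    (b c d : ℕ) →
    b ≤ ⌈ count m σ 1 /2⌉ → c ≤ ⌈ count m σ 2 /2⌉ → d ≤ count m σ 3 →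
    Σ (Question m) λ Q →
      FourInterval m Q ×
      qcount m σ Q 0 ≡ 0 × qcount m σ Q 1 ≡ b × qcount m σ Q 2 ≡ c × qcount m σ Q 3 ≡ d ×
      WellShaped m (σyes m σ Q) × WellShaped m (σno m σ Q)
-- IsState is not needed: values above 3 are simply outside the support.
lemma3 m σ _ shaped no-zeros b c d b≤ c≤ d≤ with wellShaped⇒values m σ shaped
... | lens , inj₁ shapeA = questionFromPattern patternA patternCaseA m σ lens shapeA no-zeros b≤ c≤ d≤
... | lens , inj₂ shapeB = questionFromPattern patternB patternCaseB m σ lens shapeB no-zeros b≤ c≤ d≤
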